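{- In the Mockingbird CLS, let $\mathbf{f}_{\max} = \sum_{\mathfrak{t}} \mathfrak{t}$ (sum over all combinators $\mathfrak{t}$ that are maximal elements of $\mathcal{P}$) and $\mathbf{f}_{\min} = \sum_{\mathfrak{t}}\mathfrak{t}$ (sum over all combinators that are minimal elements of $\mathcal{P}$). Then $$\mathbf{f}_{\max} = {\rm M} + {\rm M}{\rm M} + \mathbf{f}_{\max}\,\bar{\cdot}\,\mathbf{f}_{\max} - {\rm M}\,\bar{\cdot}\,\mathbf{f}_{\max}$$ and $$\mathbf{f}_{\min} = {\rm M} + {\rm M}{\rm M} + \mathbf{f}_{\min}\,\bar{\cdot}\,\mathbf{f}_{\min} - \bar{\cdot}\big(\Delta(\mathbf{f}_{\min})\big).$$
   Context: Terms over $\{{\rm M}\}$ are the smallest set $\mathfrak{T}$ containing the variables $\mathsf{x}_1,\mathsf{x}_2,\dots$, the symbol ${\rm M}$, and $(\mathfrak{t}_1\mathfrak{t}_2)$ for terms $\mathfrak{t}_1,\mathfrak{t}_2$ (application associates to the left); a combinator is a term with no variables. The rewrite relation $\Rightarrow$ is the smallest relation with ${\rm M}\,\mathfrak{s}\Rightarrow\mathfrak{s}\,\mathfrak{s}$ for every term $\mathfrak{s}$, closed under $\mathfrak{t}_1\Rightarrow\mathfrak{t}_1'$ implies $\mathfrak{t}_1\mathfrak{t}_2\Rightarrow\mathfrak{t}_1'\mathfrak{t}_2$ and $\mathfrak{t}_2\mathfrak{t}_1\Rightarrow\mathfrak{t}_2\mathfrak{t}_1'$; its reflexive-transitive closure $\preccurlyeq$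 is a partial order and $\mathcal{P}$ is the poset $(\mathfrak{T},\preccurlyeq)$. Let $\mathbb{K}$ be a field of characteristic zero. A $\mathfrak{T}$-series is a map $\mathbf{f}:\mathfrak{T}\to\mathbb{K}$, written as a formal (possibly infinite) sum $\sum_{\mathfrak{t}}\langle\mathfrak{t},\mathbf{f}\rangle\mathfrak{t}$. For series $\mathbf{f}_1,\mathbf{f}_2$, $\mathbf{f}_1\,\bar{\cdot}\,\mathbf{f}_2 = \sum_{\mathfrak{t}_1,\mathfrak{t}_2}\langle\mathfrak{t}_1,\mathbf{f}_1\rangle\langle\mathfrak{t}_2,\mathbf{f}_2\rangle\,(\mathfrak{t}_1\mathfrak{t}_2)$ (the linearization of the application product). The diagonal coproduct is $\Delta(\mathbf{f}) = \sum_{\mathfrak{t}}\langle\mathfrak{t},\mathbf{f}\rangle\,\mathfrak{t}\otimes\mathfrak{t}$, and $\bar{\cdot}$ applied to a tensor series is the linear map sending $\mathfrak{t}_1\otimes\mathfrak{t}_2$ to $\mathfrak{t}_1\mathfrak{t}_2$; thus $\bar{\cdot}(\Delta(\mathbf{f})) = \sum_{\mathfrak{t}}\langle\mathfrak{t},\mathbf{f}\rangle\,(\mathfrak{t}\mathfrak{t})$. -}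

module Defs where

open import Level using (Level; _⊔_) renaming (suc to lsuc)
open import Data.Nat using (ℕ; zero; suc)
import Data.Nat as ℕ
open import Data.Product using (Σ; _×_; _,_)
open import Relation.Nullary using (¬_; Dec; yes; no)
open import Relation.Binary.PropositionalEquality using (_≡_; refl; cong; cong₂)
open import Relation.Binary.Construct.Closure.ReflexiveTransitive using (Star)
open import Algebra.Bundles using (CommutativeRing)

infixl 9 _·_
data Term : Set where
  var : ℕ → Term
  M   : Term
  _·_ : Term → Term → Term

data Combinator : Term → Set where
  M-comb : Combinator M
  ·-comb : ∀ {t₁ t₂} → Combinator t₁ → Combinator t₂ → Combinator (t₁ · t₂)

_≟T_ : (s t : Term) → Dec (s ≡ t)
var m ≟T var n with m ℕ.≟ n
... | yes refl = yes refl
... | no ¬p = no λ { refl → ¬p refl }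
var _ ≟T M = no λ ()
var _ ≟T (_ · _) = no λ ()
M ≟T var _ = no λ ()
M ≟T M = yes refl
M ≟T (_ · _) = no λ ()
(_ · _) ≟T var _ = no λ ()
(_ · _) ≟T M = no λ ()
(s₁ · s₂) ≟T (t₁ · t₂) with s₁ ≟T t₁ | s₂ ≟T t₂
... | yes refl | yes refl = yes refl
... | no ¬p | _ = no λ { refl → ¬p refl }
... | yes _ | no ¬q = no λ { refl → ¬q refl }

infix 4 _⇒_ _≼_
data _⇒_ : Term → Term → Set where
  M-step : ∀ s → M · s ⇒ s · s
  app-l  : ∀ {t₁ t₁′} t₂ → t₁ ⇒ t₁′ → t₁ · t₂ ⇒ t₁′ · t₂
  app-r  : ∀ {t₁ t₁′} t₂ → t₁ ⇒ t₁′ → t₂ · t₁ ⇒ t₂ · t₁′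

_≼_ : Term → Term → Set
_≼_ = Star _⇒_

-- maximal / minimal elements of 𝒫 = (𝔗, ≼)
IsMaximal : Term → Set
IsMaximal t = ∀ t′ → t ≼ t′ → t′ ≡ t

IsMinimal : Term → Set
IsMinimal t = ∀ t′ → t′ ≼ t → t′ ≡ t

record IsField {c ℓ} (R : CommutativeRing c ℓ) : Set (c ⊔ ℓ) where
  open CommutativeRing R
  field
    1≉0     : ¬ (1# ≈ 0#)
    inverse : ∀ x → ¬ (x ≈ 0#) → Σ Carrier λ y → x * y ≈ 1#

module _ {c ℓ} (R : CommutativeRing c ℓ) where
  open CommutativeRing R

  ℕ→K : ℕ → Carrier
  ℕ→K zero    = 0#
  ℕ→K (suc n) = 1# + ℕ→K n

  CharZero : Set ℓ
  CharZero = ∀ n → ¬ (ℕ→K (suc n) ≈ 0#)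

module Series {c ℓ} (K : CommutativeRing c ℓ) where
  open CommutativeRing K

  𝔗-Series : Set c
  𝔗-Series = Term → Carrier

  single : Term → 𝔗-Series
  single t s with s ≟T t
  ... | yes _ = 1#
  ... | no  _ = 0#

  _⊕_ : 𝔗-Series → 𝔗-Series → 𝔗-Series
  (f ⊕ g) t = f t + g t

  _⊖_ : 𝔗-Series → 𝔗-Series → 𝔗-Series
  (f ⊖ g) t = f t - g t

  -- f₁ ·̄ f₂ = Σ_{t₁,t₂} ⟨t₁,f₁⟩⟨t₂,f₂⟩ (t₁ t₂).  Since application is
  -- injective, the coefficient of (t₁ t₂) is ⟨t₁,f₁⟩⟨t₂,f₂⟩, and the
  -- coefficient of a variable or of M is 0.
  _·̄_ : 𝔗-Series → 𝔗-Series → 𝔗-Series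
  (f₁ ·̄ f₂) (t₁ · t₂) = f₁ t₁ * f₂ t₂
  (f₁ ·̄ f₂) (var _)   = 0#
  (f₁ ·̄ f₂) M         = 0#

  -- ·̄(Δ f) = Σ_t ⟨t,f⟩ (t t): coefficient of (t₁ t₂) is ⟨t₁,f⟩ if t₁ = t₂,
  -- and 0 otherwise; coefficient of a variable or of M is 0.
  ·̄Δ : 𝔗-Series → 𝔗-Series
  ·̄Δ f (t₁ · t₂) with t₁ ≟T t₂
  ... | yes _ = f t₁
  ... | no  _ = 0#
  ·̄Δ f (var _) = 0#
  ·̄Δ f M       = 0#

  IsIndicatorOf : (Term → Set) → 𝔗-Series → Set ℓ
  IsIndicatorOf P f = ∀ t → (P t → f t ≈ 1#) × (¬ P t → f t ≈ 0#)

  _≈ˢ_ : 𝔗-Series → 𝔗-Series → Set ℓ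
  f ≈ˢ g = ∀ t → f t ≈ g t

MaxComb : Term → Set
MaxComb t = Combinator t × IsMaximal t

MinComb : Term → Set
MinComb t = Combinator t × IsMinimal t

-- A combinator a · b with a ≢ M rewrites only inside a or b, so it is maximal iff
-- a and b are, while M · b rewrites to b · b and is maximal only for b ≡ M.  Dually,
-- a root step only produces diagonal terms s · s, so a · b with a ≢ b is minimal iff
-- a and b are, while a · a arises from M · a and is minimal only for a ≡ M.  Hence
-- fmax and fmin are multiplicative off these exceptional families; the corrections
-- M ·̄ fmax and ·̄Δ fmin remove exactly what f ·̄ f puts on them, and M · M is
-- restored by hand.
module Submission where

open import Defs
open import Algebra.Bundles using (CommutativeRing)
open import Data.Product using (_×_; _,_; proj₁; proj₂)
open import Function using (id; flip; _∘_)
open import Function.Bundles using (_⇔_; mk⇔; Equivalence)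
open import Function.Properties.Equivalence using () renaming (sym to ⇔-sym)
open import Relation.Binary.Core using (Rel)
open import Relation.Binary.Construct.Closure.ReflexiveTransitive using (Star; ε; _◅_; gmap; reverse)
open import Relation.Binary.PropositionalEquality using (_≡_; _≢_; refl; cong)
open import Relation.Nullary using (¬_; Dec; yes; no; contradiction)
open import Relation.Nullary.Decidable using (map; _×-dec_)

private
  variable
    a a′ b b′ t : Term

·-injectiveˡ : a · b ≡ a′ · b′ → a ≡ a′
·-injectiveˡ refl = refl

·-injectiveʳ : a · b ≡ a′ · b′ → b ≡ b′
·-injectiveʳ refl = refl

¬Combinator-var : ∀ {n} → ¬ Combinator (var n)
¬Combinator-var ()

Combinator-·⁻ : Combinator (a · b) → Combinator a × Combinator b
Combinator-·⁻ (·-comb ca cb) = ca , cb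

≼-congˡ : a ≼ a′ → a · b ≼ a′ · b
≼-congˡ {b = b} = gmap (_· b) (app-l b)

≼-congʳ : b ≼ b′ → a · b ≼ a · b′
≼-congʳ {a = a} = gmap (a ·_) (app-r a)

Star-fixed : ∀ {ℓ r} {A : Set ℓ} {R : Rel A r} {x : A} →
             (∀ {y} → R x y → y ≡ x) → ∀ {y} → Star R x y → y ≡ x
Star-fixed fixed ε = refl
Star-fixed fixed (step ◅ steps) with fixed step
... | refl = Star-fixed fixed steps

IsMaximal-by-step : (∀ {u} → t ⇒ u → u ≡ t) → IsMaximal t
IsMaximal-by-step fixed _ = Star-fixed fixed

IsMinimal-by-step : (∀ {u} → u ⇒ t → u ≡ t) → IsMinimal t
IsMinimal-by-step fixed _ = Star-fixed {R = flip _⇒_} fixed ∘ reverse id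

MaxComb-M : MaxComb M
MaxComb-M = M-comb , IsMaximal-by-step λ ()

MaxComb-MM : MaxComb (M · M)
MaxComb-MM = ·-comb M-comb M-comb , IsMaximal-by-step fixed
  where
  fixed : ∀ {u} → M · M ⇒ u → u ≡ M · M
  fixed (M-step .M) = refl

MaxComb-M· : MaxComb (M · b) ⇔ (M · b ≡ M · M)
MaxComb-M· {b} = mk⇔ to from
  where
  to : MaxComb (M · b) → M · b ≡ M · M
  to (_ , maximal) with maximal _ (M-step b ◅ ε)
  ... | refl = refl

  from : M · b ≡ M · M → MaxComb (M · b)
  from refl = MaxComb-MM

MaxComb-· : a ≢ M → MaxComb (a · b) ⇔ (MaxComb a × MaxComb b)
MaxComb-· {a} {b} a≢M = mk⇔ to from
  where
  to : MaxComb (a · b) → MaxComb a × MaxComb b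
  to (cab , maximal) =
    (proj₁ (Combinator-·⁻ cab) , λ _ → ·-injectiveˡ ∘ maximal _ ∘ ≼-congˡ) ,
    (proj₂ (Combinator-·⁻ cab) , λ _ → ·-injectiveʳ ∘ maximal _ ∘ ≼-congʳ)

  from : MaxComb a × MaxComb b → MaxComb (a · b)
  from ((ca , max-a) , (cb , max-b)) = ·-comb ca cb , IsMaximal-by-step fixed
    where
    fixed : ∀ {u} → a · b ⇒ u → u ≡ a · b
    fixed (M-step _) with () ← a≢M refl
    fixed (app-l _ step) = cong (_· b) (max-a _ (step ◅ ε))
    fixed (app-r _ step) = cong (a ·_) (max-b _ (step ◅ ε))

MaxComb? : ∀ t → Dec (MaxComb t)
MaxComb? (var _) = no (¬Combinator-var ∘ proj₁)
MaxComb? M = yes MaxComb-M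
MaxComb? (a · b) with a ≟T M
... | yes refl = map (⇔-sym MaxComb-M·) ((M · b) ≟T (M · M))
... | no a≢M   = map (⇔-sym (MaxComb-· a≢M)) (MaxComb? a ×-dec MaxComb? b)

MinComb-M : MinComb M
MinComb-M = M-comb , IsMinimal-by-step λ ()

MinComb-MM : MinComb (M · M)
MinComb-MM = ·-comb M-comb M-comb , IsMinimal-by-step fixed
  where
  fixed : ∀ {u} → u ⇒ M · M → u ≡ M · M
  fixed (M-step .M) = refl

MinComb-diag : MinComb (a · a) ⇔ (a · a ≡ M · M)
MinComb-diag {a} = mk⇔ to from
  where
  to : MinComb (a · a) → a · a ≡ M · M
  to (_ , minimal) with minimal _ (M-step a ◅ ε)
  ... | refl = refl

  from : a · a ≡ M · M → MinComb (a · a)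
  from refl = MinComb-MM

MinComb-· : a ≢ b → MinComb (a · b) ⇔ (MinComb a × MinComb b)
MinComb-· {a} {b} a≢b = mk⇔ to from
  where
  to : MinComb (a · b) → MinComb a × MinComb b
  to (cab , minimal) =
    (proj₁ (Combinator-·⁻ cab) , λ _ → ·-injectiveˡ ∘ minimal _ ∘ ≼-congˡ) ,
    (proj₂ (Combinator-·⁻ cab) , λ _ → ·-injectiveʳ ∘ minimal _ ∘ ≼-congʳ)

  from : MinComb a × MinComb b → MinComb (a · b)
  from ((ca , min-a) , (cb , min-b)) = ·-comb ca cb , IsMinimal-by-step fixed
    where
    fixed : ∀ {u} → u ⇒ a · b → u ≡ a · b
    fixed (M-step _) with () ← a≢b refl
    fixed (app-l _ step) = cong (_· b) (min-a _ (step ◅ ε))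
    fixed (app-r _ step) = cong (a ·_) (min-b _ (step ◅ ε))

MinComb? : ∀ t → Dec (MinComb t)
MinComb? (var _) = no (¬Combinator-var ∘ proj₁)
MinComb? M = yes MinComb-M
MinComb? (a · b) with a ≟T b
... | yes refl = map (⇔-sym MinComb-diag) ((a · a) ≟T (M · M))
... | no a≢b   = map (⇔-sym (MinComb-· a≢b)) (MinComb? a ×-dec MinComb? b)

module Coefficients {c ℓ} (K : CommutativeRing c ℓ) where
  open CommutativeRing K renaming (refl to ≈-refl)
  open Series K
  open import Relation.Binary.Reasoning.Setoid setoid

  x+z≈y⇒x≈y-z : ∀ {x y z} → x + z ≈ y → x ≈ y - z
  x+z≈y⇒x≈y-z {x} {y} {z} x+z≈y = begin
    x               ≈⟨ +-identityʳ x ⟨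
    x + 0#          ≈⟨ +-congˡ (-‿inverseʳ z) ⟨
    x + (z - z)     ≈⟨ +-assoc x z (- z) ⟨
    (x + z) - z     ≈⟨ +-congʳ x+z≈y ⟩
    y - z           ∎

  x≈y⇒x+0≈0+y : ∀ {x y u v} → x ≈ y → u ≈ 0# → v ≈ 0# → x + u ≈ v + y
  x≈y⇒x+0≈0+y {x} {y} {u} {v} x≈y u≈0 v≈0 = begin
    x + u   ≈⟨ +-cong x≈y u≈0 ⟩
    y + 0#  ≈⟨ +-comm y 0# ⟩
    0# + y  ≈⟨ +-congʳ v≈0 ⟨
    v + y   ∎

  single-≢ : ∀ {s} → t ≢ s → single s t ≈ 0#
  single-≢ {t} {s} t≢s with t ≟T s
  ... | yes t≡s = contradiction t≡s t≢s
  ... | no _    = ≈-refl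

  ·̄Δ-diag : ∀ f → ·̄Δ f (a · a) ≈ f a
  ·̄Δ-diag {a} f with a ≟T a
  ... | yes _ = ≈-refl
  ... | no a≢a = contradiction refl a≢a

  ·̄Δ-off : ∀ f → a ≢ b → ·̄Δ f (a · b) ≈ 0#
  ·̄Δ-off {a} {b} f a≢b with a ≟T b
  ... | yes a≡b = contradiction a≡b a≢b
  ... | no _    = ≈-refl

  module Indicator {P : Term → Set} {f : 𝔗-Series} (f-ind : IsIndicatorOf P f) where

    ∈⇒≈1 : P t → f t ≈ 1#
    ∈⇒≈1 = proj₁ (f-ind _)

    ∉⇒≈0 : ¬ P t → f t ≈ 0#
    ∉⇒≈0 = proj₂ (f-ind _)

    ≈single : ∀ {s} → P t ⇔ (t ≡ s) → f t ≈ single s t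
    ≈single {t} {s} P⇔≡ with t ≟T s
    ... | yes t≡s = ∈⇒≈1 (Equivalence.from P⇔≡ t≡s)
    ... | no t≢s  = ∉⇒≈0 (t≢s ∘ Equivalence.to P⇔≡)

    ≈* : ∀ {u} → Dec (P a) → Dec (P b) → P u ⇔ (P a × P b) → f u ≈ f a * f b
    ≈* (yes pa) (yes pb) P⇔× = begin
      _            ≈⟨ ∈⇒≈1 (Equivalence.from P⇔× (pa , pb)) ⟩
      1#           ≈⟨ *-identityˡ 1# ⟨
      1# * 1#      ≈⟨ *-cong (∈⇒≈1 pa) (∈⇒≈1 pb) ⟨
      _ * _        ∎
    ≈* (no ¬pa) _ P⇔× = begin
      _            ≈⟨ ∉⇒≈0 (¬pa ∘ proj₁ ∘ Equivalence.to P⇔×) ⟩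
      0#           ≈⟨ zeroˡ _ ⟨
      0# * _       ≈⟨ *-congʳ (∉⇒≈0 ¬pa) ⟨
      _ * _        ∎
    ≈* (yes _) (no ¬pb) P⇔× = begin
      _            ≈⟨ ∉⇒≈0 (¬pb ∘ proj₂ ∘ Equivalence.to P⇔×) ⟩
      0#           ≈⟨ zeroʳ _ ⟨
      _ * 0#       ≈⟨ *-congˡ (∉⇒≈0 ¬pb) ⟨
      _ * _        ∎

  series-equation : ∀ f g → (∀ n → f (var n) ≈ 0#) → f M ≈ 1# →
    (∀ n → g (var n) ≈ 0#) → g M ≈ 0# →
    (∀ a b → f (a · b) + g (a · b) ≈ single (M · M) (a · b) + f a * f b) →
    f ≈ˢ (((single M ⊕ single (M · M)) ⊕ (f ·̄ f)) ⊖ g)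
  series-equation f g f-var f-M g-var g-M f-app = x+z≈y⇒x≈y-z ∘ coefficient
    where
    coefficient : ∀ t → f t + g t ≈ ((single M ⊕ single (M · M)) ⊕ (f ·̄ f)) t
    coefficient (var n) = begin
      f (var n) + g (var n) ≈⟨ +-cong (f-var n) (g-var n) ⟩
      0# + 0#               ≈⟨ +-identityʳ (0# + 0#) ⟨
      (0# + 0#) + 0#        ∎
    coefficient M = begin
      f M + g M             ≈⟨ +-cong f-M g-M ⟩
      1# + 0#               ≈⟨ +-identityʳ (1# + 0#) ⟨
      (1# + 0#) + 0#        ∎
    coefficient (a · b) = begin
      f (a · b) + g (a · b)                         ≈⟨ f-app a b ⟩
      single (M · M) (a · b) + f a * f b            ≈⟨ +-congʳ (+-identityˡ _) ⟨
      (0# + single (M · M) (a · b)) + f a * f b     ∎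

  MaxComb-indicator-app : ∀ {f} → IsIndicatorOf MaxComb f → ∀ a b →
    f (a · b) + (single M ·̄ f) (a · b) ≈ single (M · M) (a · b) + f a * f b
  MaxComb-indicator-app {f} f-ind a b = by-cases (a ≟T M)
    where
    open Indicator f-ind
    by-cases : Dec (a ≡ M) → f (a · b) + single M a * f b ≈ single (M · M) (a · b) + f a * f b
    by-cases (yes refl) = +-cong (≈single MaxComb-M·) (*-congʳ (sym (∈⇒≈1 MaxComb-M)))
    by-cases (no a≢M)   = x≈y⇒x+0≈0+y (≈* (MaxComb? a) (MaxComb? b) (MaxComb-· a≢M))
      (trans (*-congʳ (single-≢ {a} {M} a≢M)) (zeroˡ _))
      (single-≢ {a · b} {M · M} λ { refl → a≢M refl })

  MinComb-indicator-app : ∀ {f} → IsIndicatorOf MinComb f → ∀ a b →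
    f (a · b) + ·̄Δ f (a · b) ≈ single (M · M) (a · b) + f a * f b
  MinComb-indicator-app {f} f-ind a b = by-cases (a ≟T b)
    where
    open Indicator f-ind
    by-cases : Dec (a ≡ b) → f (a · b) + ·̄Δ f (a · b) ≈ single (M · M) (a · b) + f a * f b
    by-cases (yes refl) = +-cong (≈single MinComb-diag)
      (trans (·̄Δ-diag f) (≈* (MinComb? a) (MinComb? a) (mk⇔ (λ m → m , m) proj₁)))
    by-cases (no a≢b)   = x≈y⇒x+0≈0+y (≈* (MinComb? a) (MinComb? b) (MinComb-· a≢b))
      (·̄Δ-off f a≢b) (single-≢ {a · b} {M · M} λ { refl → a≢b refl })

proposition3p1 : ∀ {c ℓ} (K : CommutativeRing c ℓ) → IsField K → CharZero K →
    let open Series K in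
    (fmax fmin : 𝔗-Series) →
    IsIndicatorOf MaxComb fmax → IsIndicatorOf MinComb fmin →
    (fmax ≈ˢ ((((single M ⊕ single (M · M)) ⊕ (fmax ·̄ fmax)) ⊖ (single M ·̄ fmax))))
    × (fmin ≈ˢ ((((single M ⊕ single (M · M)) ⊕ (fmin ·̄ fmin)) ⊖ ·̄Δ fmin)))
proposition3p1 K _ _ fmax fmin max-ind min-ind =
    series-equation fmax (single M ·̄ fmax)
      (λ _ → Max.∉⇒≈0 (¬Combinator-var ∘ proj₁)) (Max.∈⇒≈1 MaxComb-M)
      (λ _ → ≈-refl) ≈-refl (MaxComb-indicator-app max-ind)
  , series-equation fmin (·̄Δ fmin)
      (λ _ → Min.∉⇒≈0 (¬Combinator-var ∘ proj₁)) (Min.∈⇒≈1 MinComb-M)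
      (λ _ → ≈-refl) ≈-refl (MinComb-indicator-app min-ind)
  where
  open CommutativeRing K using () renaming (refl to ≈-refl)
  open Series K
  open Coefficients K
  module Max = Indicator max-ind
  module Min = Indicator min-ind
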